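{- Let $m\ge1$. Then: (1) $x_m$ and $y_m$ are involutions; (2) $x_my_m=y_mx_m=w_0$, the longest element of $S_{2^m}$ (the permutation $i\mapsto 2^m-1-i$); (3) $x_m,y_m\in\mathrm{DWD}_m$; (4) $\ell(x_m)=2^{m-2}(2^m-(m+1))$ and $\ell(y_m)=2^{m-2}(2^m+(m-1))$, so $\ell(y_m)-\ell(x_m)=m2^{m-1}$.
   Context: Let $[n]=\{0,\dots,n-1\}$, $S_n$ the bijections of $[n]$. Identify $\mathbb{F}_2^m$ with $[2^m]$ via $(a_0,\dots,a_{m-1})\mapsto\sum_i a_i2^{m-1-i}$. A basic $k$-interval ($0\le k\le m$) is $\{c2^k,\dots,(c+1)2^k-1\}\subseteq[2^m]$. $\pi\in S_{2^m}$ is dyadically well-distributed if for every basic $k_1$-interval $S$ and basic $k_2$-interval $T$ with $k_1+k_2=m$ there is exactly one $i\in S$ with $\pi(i)\in T$; $\mathrm{DWD}_m$ is the set of these. Define $x_1=(0,1)$ (one-line notation) and $x_{m+1}=(x_m(0),x_m(0)+2^m,x_m(1),x_m(1)+2^m,\dots,x_m(2^m-1),x_m(2^m-1)+2^m)$; let $y_m=(x_m(2^m-1),\dots,x_m(0))$ be the reversal of $x_m$ in one-line notation. $\ell(\pi)$ is the number of inversions $\#\{(i,j):i<j,\pi(i)>\pi(j)\}$. -}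

module Defs where

open import Data.Nat using (ℕ; zero; suc; _+_; _*_; _∸_; _^_; _≤_; _<_; _<ᵇ_)
open import Data.Bool using (Bool; if_then_else_)
open import Data.List using (List; []; _∷_; concatMap; reverse; length)
open import Data.Product using (Σ; _×_)
open import Relation.Binary.PropositionalEquality using (_≡_)

-- One-line notation: a permutation of [n] is the list (π(0), …, π(n-1)).
-- Value of π at i (0-indexed); out-of-range indices give 0 (never used,
-- all statements only look at i < n).
at : List ℕ → ℕ → ℕ
at []      _       = 0
at (a ∷ l) zero    = a
at (a ∷ l) (suc i) = at l i

IsPerm : ℕ → List ℕ → Set
IsPerm n π = (length π ≡ n)
           × (∀ i → i < n → at π i < n)
           × (∀ i j → i < n → j < n → at π i ≡ at π j → i ≡ j)

IsInvolution : ℕ → List ℕ → Set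
IsInvolution n π = IsPerm n π × (∀ i → i < n → at π (at π i) ≡ i)

-- x₀ = (0) (the identity of S₁); x_{m+1} = (x_m(0), x_m(0)+2^m, x_m(1), x_m(1)+2^m, …).
-- So x 1 = (0,1) definitionally, matching the paper's x₁.
x : ℕ → List ℕ
x zero    = 0 ∷ []
x (suc m) = concatMap (λ a → a ∷ (a + 2 ^ m) ∷ []) (x m)

y : ℕ → List ℕ
y m = reverse (x m)

InBasic : ℕ → ℕ → ℕ → Set
InBasic k c j = (c * 2 ^ k ≤ j) × (j < suc c * 2 ^ k)

DWD : ℕ → List ℕ → Set
DWD m π = IsPerm (2 ^ m) π
  × (∀ k₁ k₂ → k₁ + k₂ ≡ m → ∀ c d → c < 2 ^ k₂ → d < 2 ^ k₁ →
       Σ ℕ λ i → (InBasic k₁ c i × InBasic k₂ d (at π i))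
         × (∀ i' → InBasic k₁ c i' → InBasic k₂ d (at π i') → i' ≡ i))

countLess : ℕ → List ℕ → ℕ
countLess a []      = 0
countLess a (b ∷ l) = if b <ᵇ a then suc (countLess a l) else countLess a l

inversions : List ℕ → ℕ
inversions []      = 0
inversions (a ∷ l) = countLess a l + inversions l

-- x_m is the bit-reversal permutation of [2^m]: interleaving x_m with x_m + 2^m makes
-- the lowest bit of a position the highest bit of its value. Its reversal y_m is bit
-- reversal followed by complementing every bit, i ↦ 2^m − 1 − i. Bit reversal is an
-- involution that commutes with complement, which gives the involution and w₀ claims.
-- Writing i = c·2^k₁ + u with u < 2^k₁, bit reversal sends i to rev(u)·2^k₂ + rev(c),
-- so the basic k₁-interval c meets the preimage of the basic k₂-interval d exactly at
-- u = rev(d); complement permutes the basic intervals, so y_m is well distributed too.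
-- Interleaving a word of n values below N with its shift by N doubles the inversions
-- and adds n(n−1)/2 (and n more when the shifted copy comes first, as for y_m); these
-- recurrences solve to the stated closed forms.

module Submission where

open import Defs
open import Data.Nat using (ℕ; zero; suc; _+_; _*_; _∸_; _^_; _≤_; _<_; z≤n; s≤s; _<ᵇ_; _/_; _%_)
open import Data.Nat.Properties
open import Data.Nat.DivMod using (m≡m%n+[m/n]*n; m%n<n; m<n⇒m%n≡m; [m+kn]%n≡m%n; +-distrib-/-∣ʳ; m<n⇒m/n≡0; m*n/n≡m)
open import Data.Nat.Divisibility using (divides)
open import Data.Nat.Tactic.RingSolver using (solve-∀)
open import Data.Bool using (true; false; if_then_else_)
open import Data.List using (List; []; _∷_; concatMap; reverse; length; _++_; _∷ʳ_)
open import Data.List.Properties using (unfold-reverse; length-reverse; ++-assoc)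
open import Data.List.Relation.Unary.All using (All; []; _∷_)
open import Data.Product using (Σ; _×_; _,_; proj₁)
open import Data.Empty using (⊥-elim)
open import Relation.Binary.Definitions using (tri<; tri≈; tri>)
open import Relation.Binary.PropositionalEquality

split-lastBit : ∀ i → Σ ℕ λ b → Σ ℕ λ q → b < 2 × i ≡ b + q * 2
split-lastBit i = i % 2 , i / 2 , m%n<n i 2 , m≡m%n+[m/n]*n i 2

lastBit-% : ∀ {b} q → b < 2 → (b + q * 2) % 2 ≡ b
lastBit-% {b} q b<2 = trans ([m+kn]%n≡m%n b q 2) (m<n⇒m%n≡m b<2)

lastBit-/ : ∀ {b} q → b < 2 → (b + q * 2) / 2 ≡ q
lastBit-/ {b} q b<2 = begin
  (b + q * 2) / 2       ≡⟨ +-distrib-/-∣ʳ b (divides q refl) ⟩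
  b / 2 + q * 2 / 2     ≡⟨ cong₂ _+_ (m<n⇒m/n≡0 b<2) (m*n/n≡m q 2) ⟩
  q                     ∎
  where open ≡-Reasoning

quotient-< : ∀ b q n → b + q * 2 < 2 * n → q < n
quotient-< b q n lt = *-cancelˡ-< 2 q n (begin-strict
  2 * q      ≡⟨ *-comm 2 q ⟩
  q * 2      ≤⟨ m≤n+m (q * 2) b ⟩
  b + q * 2  <⟨ lt ⟩
  2 * n      ∎)
  where open ≤-Reasoning

bitReverse : ℕ → ℕ → ℕ
bitReverse zero    i = 0
bitReverse (suc m) i = bitReverse m (i / 2) + i % 2 * 2 ^ m

bitReverse-< : ∀ m i → bitReverse m i < 2 ^ m
bitReverse-< zero    i = s≤s z≤n
bitReverse-< (suc m) i =
  +-mono-<-≤ (bitReverse-< m (i / 2)) (*-monoˡ-≤ (2 ^ m) (≤-pred (m%n<n i 2)))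

bitReverse-step : ∀ m q {b} → b < 2 → bitReverse (suc m) (b + q * 2) ≡ bitReverse m q + b * 2 ^ m
bitReverse-step m q b<2 rewrite lastBit-/ q b<2 | lastBit-% q b<2 = refl

bitReverse-split : ∀ k₁ k₂ c u → u < 2 ^ k₁ →
  bitReverse (k₁ + k₂) (c * 2 ^ k₁ + u) ≡ bitReverse k₁ u * 2 ^ k₂ + bitReverse k₂ c
bitReverse-split zero    k₂ c zero    _        = cong (bitReverse k₂) (trans (+-identityʳ _) (*-identityʳ c))
bitReverse-split zero    k₂ c (suc u) (s≤s ())
bitReverse-split (suc k) k₂ c u u< with split-lastBit u
... | b , q , b<2 , refl = begin
  bitReverse (suc (k + k₂)) (c * 2 ^ suc k + (b + q * 2))
    ≡⟨ cong (bitReverse (suc (k + k₂))) (regroup c (2 ^ k) b q) ⟩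
  bitReverse (suc (k + k₂)) (b + (c * 2 ^ k + q) * 2)
    ≡⟨ bitReverse-step (k + k₂) _ b<2 ⟩
  bitReverse (k + k₂) (c * 2 ^ k + q) + b * 2 ^ (k + k₂)
    ≡⟨ cong₂ _+_ (bitReverse-split k k₂ c q (quotient-< b q _ u<)) (cong (b *_) (^-distribˡ-+-* 2 k k₂)) ⟩
  bitReverse k q * 2 ^ k₂ + bitReverse k₂ c + b * (2 ^ k * 2 ^ k₂)
    ≡⟨ collect (bitReverse k q) (2 ^ k₂) (bitReverse k₂ c) b (2 ^ k) ⟩
  (bitReverse k q + b * 2 ^ k) * 2 ^ k₂ + bitReverse k₂ c
    ≡⟨ cong (λ z → z * 2 ^ k₂ + bitReverse k₂ c) (bitReverse-step k q b<2) ⟨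
  bitReverse (suc k) (b + q * 2) * 2 ^ k₂ + bitReverse k₂ c ∎
  where
  open ≡-Reasoning
  regroup : ∀ c K b q → c * (2 * K) + (b + q * 2) ≡ b + (c * K + q) * 2
  regroup = solve-∀
  collect : ∀ R L E b K → R * L + E + b * (K * L) ≡ (R + b * K) * L + E
  collect = solve-∀

bitReverse-append : ∀ m u {c} → u < 2 ^ m → c < 2 → bitReverse (suc m) (u + c * 2 ^ m) ≡ bitReverse m u * 2 + c
bitReverse-append m u {c} u< c<2 = begin
  bitReverse (suc m) (u + c * 2 ^ m) ≡⟨ cong₂ bitReverse (+-comm 1 m) (+-comm u (c * 2 ^ m)) ⟩
  bitReverse (m + 1) (c * 2 ^ m + u) ≡⟨ bitReverse-split m 1 c u u< ⟩
  bitReverse m u * 2 + c % 2 * 1     ≡⟨ cong (bitReverse m u * 2 +_) (trans (*-identityʳ _) (m<n⇒m%n≡m c<2)) ⟩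
  bitReverse m u * 2 + c             ∎
  where open ≡-Reasoning

bitReverse-involutive : ∀ m i → i < 2 ^ m → bitReverse m (bitReverse m i) ≡ i
bitReverse-involutive zero    zero    _        = refl
bitReverse-involutive zero    (suc i) (s≤s ())
bitReverse-involutive (suc m) i i< with split-lastBit i
... | b , q , b<2 , refl = begin
  bitReverse (suc m) (bitReverse (suc m) (b + q * 2)) ≡⟨ cong (bitReverse (suc m)) (bitReverse-step m q b<2) ⟩
  bitReverse (suc m) (bitReverse m q + b * 2 ^ m)    ≡⟨ bitReverse-append m (bitReverse m q) (bitReverse-< m q) b<2 ⟩
  bitReverse m (bitReverse m q) * 2 + b              ≡⟨ cong (λ z → z * 2 + b) (bitReverse-involutive m q (quotient-< b q _ i<)) ⟩
  q * 2 + b                                          ≡⟨ +-comm (q * 2) b ⟩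
  b + q * 2                                          ∎
  where open ≡-Reasoning

spread : ℕ → List ℕ → List ℕ
spread N []      = []
spread N (a ∷ l) = a ∷ a + N ∷ spread N l

spread′ : ℕ → List ℕ → List ℕ
spread′ N []      = []
spread′ N (a ∷ l) = a + N ∷ a ∷ spread′ N l

concatMap≡spread : ∀ N l → concatMap (λ a → a ∷ a + N ∷ []) l ≡ spread N l
concatMap≡spread N []      = refl
concatMap≡spread N (a ∷ l) = cong (λ t → a ∷ a + N ∷ t) (concatMap≡spread N l)

spread′-++ : ∀ N l k → spread′ N (l ++ k) ≡ spread′ N l ++ spread′ N k
spread′-++ N []      k = refl
spread′-++ N (a ∷ l) k = cong (λ t → a + N ∷ a ∷ t) (spread′-++ N l k)

reverse-spread : ∀ N l → reverse (spread N l) ≡ spread′ N (reverse l)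
reverse-spread N []      = refl
reverse-spread N (a ∷ l) = begin
  reverse (a ∷ a + N ∷ spread N l)             ≡⟨ unfold-reverse a (a + N ∷ spread N l) ⟩
  reverse (a + N ∷ spread N l) ∷ʳ a            ≡⟨ cong (_∷ʳ a) (unfold-reverse (a + N) (spread N l)) ⟩
  (reverse (spread N l) ∷ʳ (a + N)) ∷ʳ a       ≡⟨ ++-assoc (reverse (spread N l)) _ _ ⟩
  reverse (spread N l) ++ spread′ N (a ∷ [])   ≡⟨ cong (_++ spread′ N (a ∷ [])) (reverse-spread N l) ⟩
  spread′ N (reverse l) ++ spread′ N (a ∷ [])  ≡⟨ spread′-++ N (reverse l) (a ∷ []) ⟨
  spread′ N (reverse l ∷ʳ a)                   ≡⟨ cong (spread′ N) (unfold-reverse a l) ⟨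
  spread′ N (reverse (a ∷ l))                  ∎
  where open ≡-Reasoning

x-suc : ∀ m → x (suc m) ≡ spread (2 ^ m) (x m)
x-suc m = concatMap≡spread (2 ^ m) (x m)

y-suc : ∀ m → y (suc m) ≡ spread′ (2 ^ m) (y m)
y-suc m = trans (cong reverse (x-suc m)) (reverse-spread (2 ^ m) (x m))

length-spread : ∀ N l → length (spread N l) ≡ length l * 2
length-spread N []      = refl
length-spread N (a ∷ l) = cong (λ n → suc (suc n)) (length-spread N l)

length-x : ∀ m → length (x m) ≡ 2 ^ m
length-x zero    = refl
length-x (suc m) = begin
  length (x (suc m))            ≡⟨ cong length (x-suc m) ⟩
  length (spread (2 ^ m) (x m)) ≡⟨ length-spread (2 ^ m) (x m) ⟩
  length (x m) * 2              ≡⟨ cong (_* 2) (length-x m) ⟩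
  2 ^ m * 2                     ≡⟨ *-comm (2 ^ m) 2 ⟩
  2 ^ suc m                     ∎
  where open ≡-Reasoning

length-y : ∀ m → length (y m) ≡ 2 ^ m
length-y m = trans (length-reverse (x m)) (length-x m)

at-spread : ∀ N l q {b} → b < 2 → q < length l → at (spread N l) (b + q * 2) ≡ at l q + b * N
at-spread N (a ∷ l) zero    (s≤s z≤n)       _       = sym (+-identityʳ a)
at-spread N (a ∷ l) zero    (s≤s (s≤s z≤n)) _       = cong (a +_) (sym (+-identityʳ N))
at-spread N (a ∷ l) (suc q) (s≤s z≤n)       (s≤s q<) = at-spread N l q (s≤s z≤n) q<
at-spread N (a ∷ l) (suc q) (s≤s (s≤s z≤n)) (s≤s q<) = at-spread N l q (s≤s (s≤s z≤n)) q<

at-spread′ : ∀ N l q {b} → b < 2 → q < length l → at (spread′ N l) (b + q * 2) ≡ at l q + (1 ∸ b) * N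
at-spread′ N (a ∷ l) zero    (s≤s z≤n)       _       = cong (a +_) (sym (+-identityʳ N))
at-spread′ N (a ∷ l) zero    (s≤s (s≤s z≤n)) _       = sym (+-identityʳ a)
at-spread′ N (a ∷ l) (suc q) (s≤s z≤n)       (s≤s q<) = at-spread′ N l q (s≤s z≤n) q<
at-spread′ N (a ∷ l) (suc q) (s≤s (s≤s z≤n)) (s≤s q<) = at-spread′ N l q (s≤s (s≤s z≤n)) q<

at-x : ∀ m i → i < 2 ^ m → at (x m) i ≡ bitReverse m i
at-x zero    zero    _        = refl
at-x zero    (suc i) (s≤s ())
at-x (suc m) i       i<       with split-lastBit i
... | b , q , b<2 , refl = begin
  at (x (suc m)) (b + q * 2)           ≡⟨ cong (λ l → at l (b + q * 2)) (x-suc m) ⟩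
  at (spread (2 ^ m) (x m)) (b + q * 2) ≡⟨ at-spread _ (x m) q b<2 (subst (q <_) (sym (length-x m)) q<) ⟩
  at (x m) q + b * 2 ^ m               ≡⟨ cong (_+ b * 2 ^ m) (at-x m q q<) ⟩
  bitReverse m q + b * 2 ^ m           ≡⟨ bitReverse-step m q b<2 ⟨
  bitReverse (suc m) (b + q * 2)       ∎
  where
  open ≡-Reasoning
  q< : q < 2 ^ m
  q< = quotient-< b q (2 ^ m) i<

at-y-suc : ∀ m q {b} → b < 2 → q < 2 ^ m → at (y (suc m)) (b + q * 2) ≡ at (y m) q + (1 ∸ b) * 2 ^ m
at-y-suc m q b<2 q< =
  trans (cong (λ l → at l _) (y-suc m)) (at-spread′ _ (y m) q b<2 (subst (q <_) (sym (length-y m)) q<))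

digit-complement : ∀ {b} N → b < 2 → (1 ∸ b) * N + b * N ≡ N
digit-complement N (s≤s z≤n)       = trans (+-identityʳ _) (+-identityʳ N)
digit-complement N (s≤s (s≤s z≤n)) = +-identityʳ N

at-y+bitReverse : ∀ m i → i < 2 ^ m → suc (at (y m) i + bitReverse m i) ≡ 2 ^ m
at-y+bitReverse zero    zero    _        = refl
at-y+bitReverse zero    (suc i) (s≤s ())
at-y+bitReverse (suc m) i       i<       with split-lastBit i
... | b , q , b<2 , refl = begin
  suc (at (y (suc m)) (b + q * 2) + bitReverse (suc m) (b + q * 2))
    ≡⟨ cong₂ (λ u v → suc (u + v)) (at-y-suc m q b<2 q<) (bitReverse-step m q b<2) ⟩
  suc (at (y m) q + (1 ∸ b) * N + (bitReverse m q + b * N))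
    ≡⟨ regroup (at (y m) q) (bitReverse m q) ((1 ∸ b) * N) (b * N) ⟩
  suc (at (y m) q + bitReverse m q) + ((1 ∸ b) * N + b * N)
    ≡⟨ cong₂ _+_ (at-y+bitReverse m q q<) (digit-complement N b<2) ⟩
  N + N
    ≡⟨ cong (N +_) (+-identityʳ N) ⟨
  2 ^ suc m ∎
  where
  open ≡-Reasoning
  N = 2 ^ m
  q< : q < N
  q< = quotient-< b q N i<
  regroup : ∀ Y R u v → suc (Y + u + (R + v)) ≡ suc (Y + R) + (u + v)
  regroup = solve-∀

at-y-< : ∀ m i → i < 2 ^ m → at (y m) i < 2 ^ m
at-y-< m i i< = subst (at (y m) i <_) (at-y+bitReverse m i i<) (s≤s (m≤m+n _ _))

bitReverse-at-y+id : ∀ m i → i < 2 ^ m → suc (bitReverse m (at (y m) i) + i) ≡ 2 ^ m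
bitReverse-at-y+id zero    zero    _        = refl
bitReverse-at-y+id zero    (suc i) (s≤s ())
bitReverse-at-y+id (suc m) i       i<       with split-lastBit i
... | b , q , b<2 , refl = begin
  suc (bitReverse (suc m) (at (y (suc m)) (b + q * 2)) + (b + q * 2))
    ≡⟨ cong (λ u → suc (bitReverse (suc m) u + (b + q * 2))) (at-y-suc m q b<2 q<) ⟩
  suc (bitReverse (suc m) (Y + (1 ∸ b) * 2 ^ m) + (b + q * 2))
    ≡⟨ cong (λ u → suc (u + (b + q * 2))) (bitReverse-append m Y (at-y-< m q q<) (s≤s (m∸n≤m 1 b))) ⟩
  suc (bitReverse m Y * 2 + (1 ∸ b) + (b + q * 2))
    ≡⟨ regroup (bitReverse m Y) (1 ∸ b) b q ⟩
  suc ((1 ∸ b + b) + (bitReverse m Y + q) * 2)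
    ≡⟨ cong (λ u → suc (u + (bitReverse m Y + q) * 2)) (m∸n+n≡m (≤-pred b<2)) ⟩
  suc (bitReverse m Y + q) * 2
    ≡⟨ *-comm _ 2 ⟩
  2 * suc (bitReverse m Y + q)
    ≡⟨ cong (2 *_) (bitReverse-at-y+id m q q<) ⟩
  2 ^ suc m ∎
  where
  open ≡-Reasoning
  Y = at (y m) q
  q< : q < 2 ^ m
  q< = quotient-< b q (2 ^ m) i<
  regroup : ∀ R u b q → suc (R * 2 + u + (b + q * 2)) ≡ suc ((u + b) + (R + q) * 2)
  regroup = solve-∀

selfInverse⇒IsInvolution : ∀ n π → length π ≡ n → (∀ i → i < n → at π i < n) →
  (∀ i → i < n → at π (at π i) ≡ i) → IsInvolution n π
selfInverse⇒IsInvolution n π len bounded selfInverse = (len , bounded , injective) , selfInverse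
  where
  injective : ∀ i j → i < n → j < n → at π i ≡ at π j → i ≡ j
  injective i j i< j< eq = trans (sym (selfInverse i i<)) (trans (cong (at π) eq) (selfInverse j j<))

suc[m+n]≡o⇒m≡o∸1∸n : ∀ {m n o} → suc (m + n) ≡ o → m ≡ o ∸ 1 ∸ n
suc[m+n]≡o⇒m≡o∸1∸n {m} {n} refl = sym (m+n∸n≡m m n)

x-involution : ∀ m → IsInvolution (2 ^ m) (x m)
x-involution m = selfInverse⇒IsInvolution (2 ^ m) (x m) (length-x m) bounded selfInverse
  where
  bounded : ∀ i → i < 2 ^ m → at (x m) i < 2 ^ m
  bounded i i< = subst (_< 2 ^ m) (sym (at-x m i i<)) (bitReverse-< m i)
  selfInverse : ∀ i → i < 2 ^ m → at (x m) (at (x m) i) ≡ i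
  selfInverse i i< = begin
    at (x m) (at (x m) i)          ≡⟨ cong (at (x m)) (at-x m i i<) ⟩
    at (x m) (bitReverse m i)      ≡⟨ at-x m (bitReverse m i) (bitReverse-< m i) ⟩
    bitReverse m (bitReverse m i)  ≡⟨ bitReverse-involutive m i i< ⟩
    i                              ∎
    where open ≡-Reasoning

y-involution : ∀ m → IsInvolution (2 ^ m) (y m)
y-involution m = selfInverse⇒IsInvolution (2 ^ m) (y m) (length-y m) (at-y-< m) selfInverse
  where
  selfInverse : ∀ i → i < 2 ^ m → at (y m) (at (y m) i) ≡ i
  selfInverse i i< = +-cancelʳ-≡ (bitReverse m j) _ _ (suc-injective (begin
    suc (at (y m) j + bitReverse m j) ≡⟨ at-y+bitReverse m j (at-y-< m i i<) ⟩
    2 ^ m                             ≡⟨ bitReverse-at-y+id m i i< ⟨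
    suc (bitReverse m j + i)          ≡⟨ cong suc (+-comm (bitReverse m j) i) ⟩
    suc (i + bitReverse m j)          ∎))
    where
    open ≡-Reasoning
    j = at (y m) i

x∘y≡w₀ : ∀ m i → i < 2 ^ m → at (x m) (at (y m) i) ≡ 2 ^ m ∸ 1 ∸ i
x∘y≡w₀ m i i< = trans (at-x m _ (at-y-< m i i<)) (suc[m+n]≡o⇒m≡o∸1∸n (bitReverse-at-y+id m i i<))

y∘x≡w₀ : ∀ m i → i < 2 ^ m → at (y m) (at (x m) i) ≡ 2 ^ m ∸ 1 ∸ i
y∘x≡w₀ m i i< = begin
  at (y m) (at (x m) i)     ≡⟨ cong (at (y m)) (at-x m i i<) ⟩
  at (y m) (bitReverse m i) ≡⟨ suc[m+n]≡o⇒m≡o∸1∸n complements ⟩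
  2 ^ m ∸ 1 ∸ i             ∎
  where
  open ≡-Reasoning
  complements : suc (at (y m) (bitReverse m i) + i) ≡ 2 ^ m
  complements = trans (cong (λ z → suc (at (y m) (bitReverse m i) + z)) (sym (bitReverse-involutive m i i<)))
                      (at-y+bitReverse m (bitReverse m i) (bitReverse-< m i))

WellDistributed : ℕ → (ℕ → ℕ) → Set
WellDistributed m f = ∀ k₁ k₂ → k₁ + k₂ ≡ m → ∀ c d → c < 2 ^ k₂ → d < 2 ^ k₁ →
  Σ ℕ λ i → (InBasic k₁ c i × InBasic k₂ d (f i))
    × (∀ i' → InBasic k₁ c i' → InBasic k₂ d (f i') → i' ≡ i)

inBasic-< : ∀ k₁ k₂ {c i} → c < 2 ^ k₂ → InBasic k₁ c i → i < 2 ^ (k₁ + k₂)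
inBasic-< k₁ k₂ {c} {i} c< (_ , i<) = begin-strict
  i                <⟨ i< ⟩
  suc c * 2 ^ k₁   ≤⟨ *-monoˡ-≤ (2 ^ k₁) c< ⟩
  2 ^ k₂ * 2 ^ k₁  ≡⟨ *-comm (2 ^ k₂) _ ⟩
  2 ^ k₁ * 2 ^ k₂  ≡⟨ ^-distribˡ-+-* 2 k₁ k₂ ⟨
  2 ^ (k₁ + k₂)    ∎
  where open ≤-Reasoning

offset-inBasic : ∀ k c {u} → u < 2 ^ k → InBasic k c (c * 2 ^ k + u)
offset-inBasic k c {u} u< = m≤m+n _ u , subst (c * 2 ^ k + u <_) (+-comm (c * 2 ^ k) (2 ^ k)) (+-monoʳ-< (c * 2 ^ k) u<)

inBasic⇒offset : ∀ k c {j} → InBasic k c j → Σ ℕ λ u → u < 2 ^ k × j ≡ c * 2 ^ k + u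
inBasic⇒offset k c {j} (lo , hi) = j ∸ c * 2 ^ k , u< , sym (m+[n∸m]≡n lo)
  where
  u< : j ∸ c * 2 ^ k < 2 ^ k
  u< = +-cancelˡ-< (c * 2 ^ k) _ _ (subst₂ _<_ (sym (m+[n∸m]≡n lo)) (+-comm (2 ^ k) (c * 2 ^ k)) hi)

inBasic-unique : ∀ k {a d e} → e < 2 ^ k → InBasic k d (a * 2 ^ k + e) → a ≡ d
inBasic-unique k {a} {d} {e} e< (lo , hi) with <-cmp a d
... | tri≈ _ a≡d _ = a≡d
... | tri< a<d _ _ = ⊥-elim (<-irrefl refl (begin-strict
      K + a * K  ≤⟨ *-monoˡ-≤ K a<d ⟩
      d * K      ≤⟨ lo ⟩
      a * K + e  <⟨ +-monoʳ-< (a * K) e< ⟩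
      a * K + K  ≡⟨ +-comm (a * K) K ⟩
      K + a * K  ∎))
  where
  open ≤-Reasoning
  K = 2 ^ k
... | tri> _ _ d<a = ⊥-elim (<-irrefl refl (begin-strict
      K + d * K  ≤⟨ *-monoˡ-≤ K d<a ⟩
      a * K      ≤⟨ m≤m+n _ e ⟩
      a * K + e  <⟨ hi ⟩
      K + d * K  ∎))
  where
  open ≤-Reasoning
  K = 2 ^ k

inBasic-complement : ∀ k₁ k₂ d d' {j j'} → suc (d + d') ≡ 2 ^ k₁ → suc (j' + j) ≡ 2 ^ (k₁ + k₂) →
  InBasic k₂ d' j → InBasic k₂ d j'
inBasic-complement k₁ k₂ d d' {j} {j'} d+d' j'+j (lo , hi) = lo' , hi'
  where
  open ≤-Reasoning
  K = 2 ^ k₂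
  total : suc (j' + j) ≡ K + d * K + d' * K
  total = begin-equality
    suc (j' + j)      ≡⟨ j'+j ⟩
    2 ^ (k₁ + k₂)     ≡⟨ ^-distribˡ-+-* 2 k₁ k₂ ⟩
    2 ^ k₁ * K        ≡⟨ cong (_* K) d+d' ⟨
    suc (d + d') * K  ≡⟨ expand K d d' ⟩
    K + d * K + d' * K ∎
    where
    expand : ∀ K d d' → suc (d + d') * K ≡ K + d * K + d' * K
    expand = solve-∀
  lo' : d * K ≤ j'
  lo' = +-cancelʳ-≤ (suc j) (d * K) j' (begin
    d * K + suc j         ≤⟨ +-monoʳ-≤ (d * K) hi ⟩
    d * K + (K + d' * K)  ≡⟨ swap (d * K) K (d' * K) ⟩
    K + d * K + d' * K    ≡⟨ total ⟨
    suc (j' + j)          ≡⟨ +-suc j' j ⟨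
    j' + suc j            ∎)
    where
    swap : ∀ a b c → a + (b + c) ≡ b + a + c
    swap = solve-∀
  hi' : j' < K + d * K
  hi' = +-cancelʳ-≤ (d' * K) (suc j') (K + d * K) (begin
    suc j' + d' * K     ≤⟨ +-monoʳ-≤ (suc j') lo ⟩
    suc (j' + j)        ≡⟨ total ⟩
    K + d * K + d' * K  ∎)

wellDistributed-cong : ∀ m {f g} → (∀ i → i < 2 ^ m → f i ≡ g i) → WellDistributed m f → WellDistributed m g
wellDistributed-cong m f≗g wd k₁ k₂ refl c d c< d< =
  let i , (inS , inT) , unique = wd k₁ k₂ refl c d c< d<
  in i , (inS , subst (InBasic k₂ d) (f≗g i (inBasic-< k₁ k₂ c< inS)) inT) ,
     λ i' inS' inT' → unique i' inS' (subst (InBasic k₂ d) (sym (f≗g i' (inBasic-< k₁ k₂ c< inS'))) inT')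

bitReverse-wellDistributed : ∀ m → WellDistributed m (bitReverse m)
bitReverse-wellDistributed m k₁ k₂ refl c d c< d< = i , (offset-inBasic k₁ c (bitReverse-< k₁ d) , hit) , unique
  where
  i = c * 2 ^ k₁ + bitReverse k₁ d
  bitReverse-i : bitReverse (k₁ + k₂) i ≡ d * 2 ^ k₂ + bitReverse k₂ c
  bitReverse-i = trans (bitReverse-split k₁ k₂ c _ (bitReverse-< k₁ d))
                       (cong (λ z → z * 2 ^ k₂ + bitReverse k₂ c) (bitReverse-involutive k₁ d d<))
  hit : InBasic k₂ d (bitReverse (k₁ + k₂) i)
  hit = subst (InBasic k₂ d) (sym bitReverse-i) (offset-inBasic k₂ d (bitReverse-< k₂ c))
  unique : ∀ i' → InBasic k₁ c i' → InBasic k₂ d (bitReverse (k₁ + k₂) i') → i' ≡ i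
  unique i' inS inT with inBasic⇒offset k₁ c inS
  ... | u , u< , refl = cong (c * 2 ^ k₁ +_) (begin
    u                               ≡⟨ bitReverse-involutive k₁ u u< ⟨
    bitReverse k₁ (bitReverse k₁ u) ≡⟨ cong (bitReverse k₁) (inBasic-unique k₂ (bitReverse-< k₂ c) inT′) ⟩
    bitReverse k₁ d                 ∎)
    where
    open ≡-Reasoning
    inT′ : InBasic k₂ d (bitReverse k₁ u * 2 ^ k₂ + bitReverse k₂ c)
    inT′ = subst (InBasic k₂ d) (bitReverse-split k₁ k₂ c u u<) inT

-- Complementing values sends the basic k₂-interval indexed 2^k₁ − 1 − d onto the one indexed d.
complement-wellDistributed : ∀ m {f g} → (∀ i → i < 2 ^ m → suc (g i + f i) ≡ 2 ^ m) →
  WellDistributed m f → WellDistributed m g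
complement-wellDistributed m {f} {g} g+f wd k₁ k₂ refl c d c< d< =
  let i , (inS , inT) , unique = wd k₁ k₂ refl c d' c< d'<
  in i , (inS , inBasic-complement k₁ k₂ d d' d+d' (g+f i (inBasic-< k₁ k₂ c< inS)) inT) ,
     λ i' inS' inT' → unique i' inS' (inBasic-complement k₁ k₂ d' d d'+d (f+g i' inS') inT')
  where
  d' = 2 ^ k₁ ∸ suc d
  d+d' : suc (d + d') ≡ 2 ^ k₁
  d+d' = m+[n∸m]≡n d<
  d'+d : suc (d' + d) ≡ 2 ^ k₁
  d'+d = trans (cong suc (+-comm d' d)) d+d'
  d'< : d' < 2 ^ k₁
  d'< = subst (d' <_) d+d' (s≤s (m≤n+m d' d))
  f+g : ∀ i → InBasic k₁ c i → suc (f i + g i) ≡ 2 ^ (k₁ + k₂)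
  f+g i inS = trans (cong suc (+-comm (f i) (g i))) (g+f i (inBasic-< k₁ k₂ c< inS))

x-dwd : ∀ m → DWD m (x m)
x-dwd m = proj₁ (x-involution m) , wellDistributed-cong m (λ i i< → sym (at-x m i i<)) (bitReverse-wellDistributed m)

y-dwd : ∀ m → DWD m (y m)
y-dwd m = proj₁ (y-involution m) , complement-wellDistributed m (at-y+bitReverse m) (bitReverse-wellDistributed m)

<⇒<ᵇ≡true : ∀ {m n} → m < n → (m <ᵇ n) ≡ true
<⇒<ᵇ≡true {zero}  {suc n} _          = refl
<⇒<ᵇ≡true {suc m} {suc n} (s≤s m<n) = <⇒<ᵇ≡true m<n

≤⇒<ᵇ≡false : ∀ {m n} → n ≤ m → (m <ᵇ n) ≡ false
≤⇒<ᵇ≡false {m}     {zero}  _          = refl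
≤⇒<ᵇ≡false {suc m} {suc n} (s≤s n≤m) = ≤⇒<ᵇ≡false n≤m

+-<ᵇ-+ : ∀ b a N → (b + N <ᵇ a + N) ≡ (b <ᵇ a)
+-<ᵇ-+ b a zero    rewrite +-identityʳ b | +-identityʳ a = refl
+-<ᵇ-+ b a (suc N) rewrite +-suc b N | +-suc a N = +-<ᵇ-+ b a N

if-+ : ∀ t L c → (if t then suc (L + c) else L + c) ≡ L + (if t then suc c else c)
if-+ true  L c = sym (+-suc L c)
if-+ false L c = refl

countLess-spread : ∀ N a l → a < N → All (_< N) l → countLess a (spread N l) ≡ countLess a l
countLess-spread N a []      _  _          = refl
countLess-spread N a (b ∷ l) a< (b< ∷ l<)
  rewrite ≤⇒<ᵇ≡false (≤-trans (<⇒≤ a<) (m≤n+m N b)) | countLess-spread N a l a< l< = refl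

countLess-spread′ : ∀ N a l → a < N → All (_< N) l → countLess a (spread′ N l) ≡ countLess a l
countLess-spread′ N a []      _  _          = refl
countLess-spread′ N a (b ∷ l) a< (b< ∷ l<)
  rewrite ≤⇒<ᵇ≡false (≤-trans (<⇒≤ a<) (m≤n+m N b)) | countLess-spread′ N a l a< l< = refl

countLess+-spread : ∀ N a l → All (_< N) l → countLess (a + N) (spread N l) ≡ length l + countLess a l
countLess+-spread N a []      _          = refl
countLess+-spread N a (b ∷ l) (b< ∷ l<)
  rewrite <⇒<ᵇ≡true (≤-trans b< (m≤n+m N a)) | +-<ᵇ-+ b a N | countLess+-spread N a l l< =
  cong suc (if-+ (b <ᵇ a) (length l) (countLess a l))

countLess+-spread′ : ∀ N a l → All (_< N) l → countLess (a + N) (spread′ N l) ≡ length l + countLess a l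
countLess+-spread′ N a []      _          = refl
countLess+-spread′ N a (b ∷ l) (b< ∷ l<)
  rewrite <⇒<ᵇ≡true (≤-trans b< (m≤n+m N a)) | +-<ᵇ-+ b a N | countLess+-spread′ N a l l< =
  if-+ (b <ᵇ a) (suc (length l)) (countLess a l)

triangle : ℕ → ℕ
triangle zero    = 0
triangle (suc n) = n + triangle n

triangle-closedForm : ∀ n → 2 * triangle n + n ≡ n * n
triangle-closedForm zero    = refl
triangle-closedForm (suc n) = begin
  2 * (n + triangle n) + suc n    ≡⟨ regroup n (triangle n) ⟩
  (2 * triangle n + n) + 2 * n + 1 ≡⟨ cong (λ z → z + 2 * n + 1) (triangle-closedForm n) ⟩
  n * n + 2 * n + 1               ≡⟨ square n ⟩
  suc n * suc n                   ∎
  where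
  open ≡-Reasoning
  regroup : ∀ n t → 2 * (n + t) + suc n ≡ 2 * t + n + 2 * n + 1
  regroup = solve-∀
  square : ∀ n → n * n + 2 * n + 1 ≡ suc n * suc n
  square = solve-∀

inversions-spread : ∀ N l → All (_< N) l → inversions (spread N l) ≡ 2 * inversions l + triangle (length l)
inversions-spread N []      _          = refl
inversions-spread N (a ∷ l) (a< ∷ l<)
  rewrite ≤⇒<ᵇ≡false (m≤m+n a N) | countLess-spread N a l a< l< | countLess+-spread N a l l< | inversions-spread N l l< =
  regroup (countLess a l) (length l) (inversions l) (triangle (length l))
  where
  regroup : ∀ c L I t → c + (L + c + (2 * I + t)) ≡ 2 * (c + I) + (L + t)
  regroup = solve-∀

inversions-spread′ : ∀ N l → All (_< N) l →
  inversions (spread′ N l) ≡ 2 * inversions l + triangle (length l) + length l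
inversions-spread′ N []      _          = refl
inversions-spread′ N (a ∷ l) (a< ∷ l<)
  rewrite <⇒<ᵇ≡true (≤-trans a< (m≤n+m N a)) | countLess+-spread′ N a l l< | countLess-spread′ N a l a< l<
        | inversions-spread′ N l l< =
  regroup (countLess a l) (length l) (inversions l) (triangle (length l))
  where
  regroup : ∀ c L I t → suc (L + c) + (c + (2 * I + t + L)) ≡ 2 * (c + I) + (L + t) + suc L
  regroup = solve-∀

All-spread : ∀ N l → All (_< N) l → All (_< 2 * N) (spread N l)
All-spread N []      _          = []
All-spread N (b ∷ l) (b< ∷ l<) = ≤-trans b< (m≤m+n N _) ∷ +-mono-<-≤ b< (m≤m+n N 0) ∷ All-spread N l l<

All-spread′ : ∀ N l → All (_< N) l → All (_< 2 * N) (spread′ N l)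
All-spread′ N []      _          = []
All-spread′ N (b ∷ l) (b< ∷ l<) = +-mono-<-≤ b< (m≤m+n N 0) ∷ ≤-trans b< (m≤m+n N _) ∷ All-spread′ N l l<

All-x-< : ∀ m → All (_< 2 ^ m) (x m)
All-x-< zero    = s≤s z≤n ∷ []
All-x-< (suc m) = subst (All (_< 2 ^ suc m)) (sym (x-suc m)) (All-spread _ (x m) (All-x-< m))

All-y-< : ∀ m → All (_< 2 ^ m) (y m)
All-y-< zero    = s≤s z≤n ∷ []
All-y-< (suc m) = subst (All (_< 2 ^ suc m)) (sym (y-suc m)) (All-spread′ _ (y m) (All-y-< m))

inversions-x-suc : ∀ m → inversions (x (suc m)) ≡ 2 * inversions (x m) + triangle (2 ^ m)
inversions-x-suc m rewrite x-suc m | inversions-spread (2 ^ m) (x m) (All-x-< m) | length-x m = refl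

inversions-y-suc : ∀ m → inversions (y (suc m)) ≡ 2 * inversions (y m) + triangle (2 ^ m) + 2 ^ m
inversions-y-suc m rewrite y-suc m | inversions-spread′ (2 ^ m) (y m) (All-y-< m) | length-y m = refl

inversions-x-closedForm : ∀ m → 4 * inversions (x m) + 2 ^ m * (m + 1) ≡ 2 ^ m * 2 ^ m
inversions-x-closedForm zero    = refl
inversions-x-closedForm (suc m) = begin
  4 * inversions (x (suc m)) + 2 * N * (suc m + 1)
    ≡⟨ cong (λ z → 4 * z + 2 * N * (suc m + 1)) (inversions-x-suc m) ⟩
  4 * (2 * inversions (x m) + triangle N) + 2 * N * (suc m + 1)
    ≡⟨ regroup (inversions (x m)) (triangle N) N m ⟩
  2 * (4 * inversions (x m) + N * (m + 1)) + 2 * (2 * triangle N + N)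
    ≡⟨ cong₂ (λ u v → 2 * u + 2 * v) (inversions-x-closedForm m) (triangle-closedForm N) ⟩
  2 * (N * N) + 2 * (N * N)
    ≡⟨ double N ⟩
  2 * N * (2 * N) ∎
  where
  open ≡-Reasoning
  N = 2 ^ m
  regroup : ∀ I t N m → 4 * (2 * I + t) + 2 * N * (suc m + 1) ≡ 2 * (4 * I + N * (m + 1)) + 2 * (2 * t + N)
  regroup = solve-∀
  double : ∀ N → 2 * (N * N) + 2 * (N * N) ≡ 2 * N * (2 * N)
  double = solve-∀

inversions-y-closedForm : ∀ m → 4 * inversions (y m) + 2 ^ m ≡ 2 ^ m * (2 ^ m + m)
inversions-y-closedForm zero    = refl
inversions-y-closedForm (suc m) = begin
  4 * inversions (y (suc m)) + 2 * N
    ≡⟨ cong (λ z → 4 * z + 2 * N) (inversions-y-suc m) ⟩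
  4 * (2 * inversions (y m) + triangle N + N) + 2 * N
    ≡⟨ regroup (inversions (y m)) (triangle N) N ⟩
  2 * (4 * inversions (y m) + N) + 2 * (2 * triangle N + N) + 2 * N
    ≡⟨ cong₂ (λ u v → 2 * u + 2 * v + 2 * N) (inversions-y-closedForm m) (triangle-closedForm N) ⟩
  2 * (N * (N + m)) + 2 * (N * N) + 2 * N
    ≡⟨ double N m ⟩
  2 * N * (2 * N + suc m) ∎
  where
  open ≡-Reasoning
  N = 2 ^ m
  regroup : ∀ J t N → 4 * (2 * J + t + N) + 2 * N ≡ 2 * (4 * J + N) + 2 * (2 * t + N) + 2 * N
  regroup = solve-∀
  double : ∀ N m → 2 * (N * (N + m)) + 2 * (N * N) + 2 * N ≡ 2 * N * (2 * N + suc m)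
  double = solve-∀

4*inversions-x : ∀ m → 4 * inversions (x m) ≡ 2 ^ m * (2 ^ m ∸ (m + 1))
4*inversions-x m = begin
  4 * inversions (x m)                                     ≡⟨ m+n∸n≡m _ (2 ^ m * (m + 1)) ⟨
  4 * inversions (x m) + 2 ^ m * (m + 1) ∸ 2 ^ m * (m + 1) ≡⟨ cong (_∸ 2 ^ m * (m + 1)) (inversions-x-closedForm m) ⟩
  2 ^ m * 2 ^ m ∸ 2 ^ m * (m + 1)                          ≡⟨ *-distribˡ-∸ (2 ^ m) (2 ^ m) (m + 1) ⟨
  2 ^ m * (2 ^ m ∸ (m + 1))                                ∎
  where open ≡-Reasoning

4*inversions-y : ∀ k → 4 * inversions (y (suc k)) ≡ 2 ^ suc k * (2 ^ suc k + k)
4*inversions-y k = +-cancelʳ-≡ (2 ^ suc k) _ _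
  (trans (inversions-y-closedForm (suc k)) (peel (2 ^ suc k) k))
  where
  peel : ∀ N k → N * (N + suc k) ≡ N * (N + k) + N
  peel = solve-∀

inversions-y≡inversions-x+ : ∀ k → inversions (y (suc k)) ≡ inversions (x (suc k)) + suc k * 2 ^ k
inversions-y≡inversions-x+ k = *-cancelˡ-≡ _ _ 4 (+-cancelʳ-≡ (2 * P) _ _ (begin
  4 * inversions (y (suc k)) + 2 * P
    ≡⟨ inversions-y-closedForm (suc k) ⟩
  2 * P * (2 * P + suc k)
    ≡⟨ *-distribˡ-+ (2 * P) (2 * P) (suc k) ⟩
  2 * P * (2 * P) + 2 * P * suc k
    ≡⟨ cong (_+ 2 * P * suc k) (inversions-x-closedForm (suc k)) ⟨
  4 * X + 2 * P * (suc k + 1) + 2 * P * suc k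
    ≡⟨ regroup X P k ⟩
  4 * (X + suc k * P) + 2 * P ∎))
  where
  open ≡-Reasoning
  P = 2 ^ k
  X = inversions (x (suc k))
  regroup : ∀ X P k → 4 * X + 2 * P * (suc k + 1) + 2 * P * suc k ≡ 4 * (X + suc k * P) + 2 * P
  regroup = solve-∀

lemma2p8 : ∀ m → 1 ≤ m →
    (IsInvolution (2 ^ m) (x m) × IsInvolution (2 ^ m) (y m))
    × ((∀ i → i < 2 ^ m → at (x m) (at (y m) i) ≡ 2 ^ m ∸ 1 ∸ i)
       × (∀ i → i < 2 ^ m → at (y m) (at (x m) i) ≡ 2 ^ m ∸ 1 ∸ i))
    × (DWD m (x m) × DWD m (y m))
    × ((4 * inversions (x m) ≡ 2 ^ m * (2 ^ m ∸ (m + 1)))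
       × (4 * inversions (y m) ≡ 2 ^ m * (2 ^ m + (m ∸ 1)))
       × (inversions (y m) ≡ inversions (x m) + m * 2 ^ (m ∸ 1)))
lemma2p8 m@(suc k) _ =
    (x-involution m , y-involution m)
  , (x∘y≡w₀ m , y∘x≡w₀ m)
  , (x-dwd m , y-dwd m)
  , (4*inversions-x m , 4*inversions-y k , inversions-y≡inversions-x+ k)
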